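{- Let $n\geq 3$ and let $Q_{2^n}$ be the generalized quaternion group of order $2^n$. Then $\mathcal{P}^{**}(Q_{2^n})$ is a line graph (of some graph).
   Context: $Q_{2^n}=\langle x,y\rangle$ where $x$ has order $2^{n-1}$, $y$ has order $4$, every element is of the form $x^a$ or $x^a y$, $x^{2^{n-2}}=y^2$, and $yxy^{ -1}=x^{ -1}$. For a finite group $G$, the power graph $\mathcal{P}(G)$ is the simple graph with vertex set $G$ in which two distinct vertices $u,v$ are adjacent iff $u^m=v$ or $v^n=u$ for some positive integers $m,n$. The proper power graph $\mathcal{P}^{**}(G)$ is obtained from $\mathcal{P}(G)$ by deleting all dominating vertices (vertices adjacent to all other vertices). A graph is a line graph if it is isomorphic to $L(\Gamma)$ for some graph $\Gamma$, where $L(\Gamma)$ has the edges of $\Gamma$ as vertices, adjacent iff they share an endpoint. -}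

module Defs where

open import Data.Nat using (ℕ; zero; suc; _+_; _∸_; _^_; NonZero)
open import Data.Nat.Properties using (m^n≢0)
open import Data.Nat.DivMod using (_%_; m%n<n)
open import Data.Fin using (Fin; toℕ; fromℕ<) renaming (_<_ to _<ᶠ_)
open import Data.Bool using (Bool; true; false)
open import Data.Product using (_×_; _,_; Σ; ∃; proj₁; proj₂)
open import Data.Sum using (_⊎_)
open import Relation.Nullary using (¬_)
open import Relation.Binary.PropositionalEquality using (_≡_; _≢_)
open import Function.Bundles using (_⇔_)

-- The element (a , b) stands for x^a y^b with a ∈ {0,…,2^(n-1)-1}, b ∈ {0,1}.
-- Relations: x^(2^(n-1)) = 1, y^2 = x^(2^(n-2)), y x y^{-1} = x^{-1}.
-- Hence  x^a y^0 · x^c y^d = x^(a+c) y^d,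
--        x^a y   · x^c     = x^(a-c) y,
--        x^a y   · x^c y   = x^(a-c+2^(n-2)).

ord-x : ℕ → ℕ
ord-x n = 2 ^ (n ∸ 1)

modx : (n : ℕ) → ℕ → Fin (ord-x n)
modx n m = fromℕ< (m%n<n m (ord-x n) {{m^n≢0 2 (n ∸ 1)}})
  where open import Data.Nat.DivMod

Q : ℕ → Set
Q n = Fin (ord-x n) × Bool

qmul : (n : ℕ) → Q n → Q n → Q n
qmul n (a , false) (c , d)     = modx n (toℕ a + toℕ c) , d
qmul n (a , true)  (c , false) = modx n (toℕ a + (ord-x n ∸ toℕ c)) , true
qmul n (a , true)  (c , true)  =
  modx n (toℕ a + (ord-x n ∸ toℕ c) + 2 ^ (n ∸ 2)) , false

qone : (n : ℕ) → Q n
qone n = modx n 0 , false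

qpow : (n : ℕ) → Q n → ℕ → Q n
qpow n g zero    = qone n
qpow n g (suc m) = qmul n g (qpow n g m)

record Graph : Set₁ where
  field
    V   : Set
    Adj : V → V → Set

open Graph public

record _≅_ (A B : Graph) : Set where
  field
    to      : V A → V B
    from    : V B → V A
    from∘to : ∀ x → from (to x) ≡ x
    to∘from : ∀ y → to (from y) ≡ y
    adj     : ∀ x y → Adj A x y ⇔ Adj B (to x) (to y)

PowAdj : (n : ℕ) → Q n → Q n → Set
PowAdj n u v =
  u ≢ v × ((∃ λ m → qpow n u (suc m) ≡ v) ⊎ (∃ λ m → qpow n v (suc m) ≡ u))

PowerGraph : ℕ → Graph
PowerGraph n = record { V = Q n ; Adj = PowAdj n }

Dominating : (Γ : Graph) → V Γ → Set
Dominating Γ g = ∀ h → h ≢ g → Adj Γ g h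

-- vertex of the induced subgraph on non-dominating vertices
-- (the proof of non-domination is irrelevant, so equality is equality of vertices)
record NonDom (Γ : Graph) : Set where
  constructor nd
  field
    vert  : V Γ
    .notD : ¬ Dominating Γ vert

open NonDom public

deleteDominating : Graph → Graph
deleteDominating Γ = record
  { V   = NonDom Γ
  ; Adj = λ x y → Adj Γ (vert x) (vert y) }

ProperPowerGraph : ℕ → Graph
ProperPowerGraph n = deleteDominating (PowerGraph n)

-- A simple graph on vertex set Fin k is given by a predicate
-- E on pairs; its edges are the pairs {u , v} with u < v and E u v
-- (each unordered pair represented once; proofs irrelevant).

record Edge (k : ℕ) (E : Fin k → Fin k → Set) : Set where
  constructor edge
  field
    src : Fin k
    tgt : Fin k
    .src<tgt : src <ᶠ tgt
    .isE     : E src tgt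

open Edge public

ShareEnd : ∀ {k E} → Edge k E → Edge k E → Set
ShareEnd e f = (src e ≡ src f) ⊎ (src e ≡ tgt f) ⊎ (tgt e ≡ src f) ⊎ (tgt e ≡ tgt f)

LineGraphOf : (k : ℕ) → (Fin k → Fin k → Set) → Graph
LineGraphOf k E = record
  { V   = Edge k E
  ; Adj = λ e f → e ≢ f × ShareEnd e f }

IsLineGraph : Graph → Set₁
IsLineGraph Γ = Σ ℕ λ k → Σ (Fin k → Fin k → Set) λ E → Γ ≅ LineGraphOf k E

module Submission where

-- In Q_{2^n} write N = 2^(n-1) and h = 2^(n-2). The powers of x form a cyclic 2-group, in
-- which of any two residues one is a multiple of the other, so their power graph is complete,
-- while the powers of x^c y are x^c y, x^h, x^(c+h) y and 1. Hence the dominating vertices are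
-- 1 and x^h, and P** is a clique on the x^a (a ≠ 0, h) plus the disjoint edges
-- {x^c y, x^(c+h) y}: the line graph of a star together with h paths of length two, where x^a
-- is the edge from hub 0 to leaf 1 + a and x^c y the edge from hub 1 + N + (c mod h) to
-- leaf 1 + N + h + c.

open import Defs
open import Data.Nat using (ℕ; _≤_)

open import Data.Bool using (true; false)
open import Data.Empty using (⊥-elim; ⊥-elim-irr)
open import Data.Fin using (Fin; toℕ; fromℕ<) renaming (_≟_ to _≟ᶠ_)
open import Data.Fin.Properties using (toℕ-injective; toℕ-fromℕ<; toℕ<n; fromℕ<-injective; fromℕ<-cong)
open import Data.List using (List; []; _∷_)
open import Data.List.Membership.Propositional using (_∈_; _∉_)
open import Data.List.Relation.Unary.Any using (here; there)
open import Data.Nat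
open import Data.Nat.Coprimality using (Coprime; coprime-divisor)
open import Data.Nat.DivMod
open import Data.Nat.Divisibility
open import Data.Nat.GCD using (gcd; gcd[m,n]∣m; gcd[m,n]∣n; gcd-GCD; module Bézout)
open import Data.Nat.Primality using (prime[2]; prime⇒irreducible)
open import Data.Nat.Properties
open import Data.Nat.Tactic.RingSolver using (solve)
open import Data.Product using (∃; ∃-syntax; _,_; _×_; proj₁; proj₂)
open import Data.Product.Function.NonDependent.Propositional using (_×-cong_)
open import Data.Sum using (_⊎_; inj₁; inj₂)
import Data.Sum as Sum
open import Data.Sum.Function.Propositional using (_⊎-cong_)
open import Function using (_∘_)
open import Function.Bundles using (_⇔_; mk⇔; Equivalence)
import Function.Properties.Equivalence as ⇔
open import Relation.Binary.PropositionalEquality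
open import Relation.Nullary using (Dec; yes; no; ¬_; contradiction; recompute)

∣2^⇒≡2^ : ∀ p {d} → d ∣ 2 ^ p → ∃[ i ] d ≡ 2 ^ i
∣2^⇒≡2^ zero d∣1 = 0 , ∣1⇒≡1 d∣1
∣2^⇒≡2^ (suc p) {d} d∣2^1+p with 2 ∣? d
... | yes (divides e refl) with ∣2^⇒≡2^ p {e} (*-cancelʳ-∣ 2 (subst (e * 2 ∣_) (*-comm 2 (2 ^ p)) d∣2^1+p))
...   | i , refl = suc i , *-comm (2 ^ i) 2
∣2^⇒≡2^ (suc p) {d} d∣2^1+p | no 2∤d = ∣2^⇒≡2^ p (coprime-divisor d⊥2 d∣2^1+p)
  where
  d⊥2 : Coprime d 2
  d⊥2 (e∣d , e∣2) with prime⇒irreducible prime[2] e∣2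
  ... | inj₁ e≡1 = e≡1
  ... | inj₂ refl = ⊥-elim (2∤d e∣d)

^-monoʳ-∣ : ∀ m {i j} → i ≤ j → m ^ i ∣ m ^ j
^-monoʳ-∣ m {i} i≤j with m≤n⇒∃[o]m+o≡n i≤j
... | o , refl = divides (m ^ o) (trans (^-distribˡ-+-* m i o) (*-comm (m ^ i) (m ^ o)))

divisors-of-2^-total : ∀ p {d e} → d ∣ 2 ^ p → e ∣ 2 ^ p → d ∣ e ⊎ e ∣ d
divisors-of-2^-total p d∣2^p e∣2^p with ∣2^⇒≡2^ p d∣2^p | ∣2^⇒≡2^ p e∣2^p
... | i , refl | j , refl with ≤-total i j
...   | inj₁ i≤j = inj₁ (^-monoʳ-∣ 2 i≤j)
...   | inj₂ j≤i = inj₂ (^-monoʳ-∣ 2 j≤i)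

[m%n+o]%n≡[m+o]%n : ∀ m o n .{{_ : NonZero n}} → (m % n + o) % n ≡ (m + o) % n
[m%n+o]%n≡[m+o]%n m o n = begin
  (m % n + o) % n         ≡⟨ %-distribˡ-+ (m % n) o n ⟩
  (m % n % n + o % n) % n ≡⟨ cong (λ z → (z + o % n) % n) (m%n%n≡m%n m n) ⟩
  (m % n + o % n) % n     ≡⟨ %-distribˡ-+ m o n ⟨
  (m + o) % n             ∎
  where open ≡-Reasoning

module _ (N : ℕ) .{{_ : NonZero N}} where

  private
    suc[N∸1]≡N : suc (N ∸ 1) ≡ N
    suc[N∸1]≡N = m+[n∸m]≡n {1} {N} (>-nonZero⁻¹ N)

  %-cong-+* : ∀ u v i j → u + i * N ≡ v + j * N → u % N ≡ v % N
  %-cong-+* u v i j eq = begin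
    u % N           ≡⟨ sym ([m+kn]%n≡m%n u i N) ⟩
    (u + i * N) % N ≡⟨ cong (_% N) eq ⟩
    (v + j * N) % N ≡⟨ [m+kn]%n≡m%n v j N ⟩
    v % N           ∎
    where open ≡-Reasoning

  linear-congruence-solvable : ∀ a b → gcd a N ∣ b → ∃[ m ] (a * m) % N ≡ b % N
  linear-congruence-solvable a b (divides q refl) with Bézout.identity (gcd-GCD a N)
  ... | Bézout.+- x y d+yN≡xa = x * q , %-cong-+* _ (q * d) 0 (q * y) (begin
      a * (x * q) + 0 * N ≡⟨ solve (a ∷ x ∷ q ∷ N ∷ []) ⟩
      q * (x * a)         ≡⟨ cong (q *_) (sym d+yN≡xa) ⟩
      q * (d + y * N)     ≡⟨ *-distribˡ-+ q d (y * N) ⟩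
      q * d + q * (y * N) ≡⟨ cong (q * d +_) (*-assoc q y N) ⟨
      q * d + (q * y) * N ∎)
    where
    open ≡-Reasoning
    d = gcd a N
  -- Here x·a ≡ −d (mod N), so N − 1 turns the multiplier x·q into one for q·d.
  ... | Bézout.-+ x y d+xa≡yN = x * q * (N ∸ 1) , %-cong-+* _ (q * d) (q * y) (x * q * a) (begin
      a * (x * q * (N ∸ 1)) + q * y * N       ≡⟨ cong (a * (x * q * (N ∸ 1)) +_) q[yN]≡q[d+xa] ⟩
      a * (x * q * (N ∸ 1)) + q * (d + x * a) ≡⟨ rearrange d (N ∸ 1) ⟩
      q * d + x * q * a * suc (N ∸ 1)         ≡⟨ cong (λ z → q * d + x * q * a * z) suc[N∸1]≡N ⟩
      q * d + x * q * a * N                   ∎)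
    where
    open ≡-Reasoning
    d = gcd a N
    q[yN]≡q[d+xa] : q * y * N ≡ q * (d + x * a)
    q[yN]≡q[d+xa] = trans (*-assoc q y N) (cong (q *_) (sym d+xa≡yN))
    rearrange : ∀ g M → a * (x * q * M) + q * (g + x * a) ≡ q * g + x * q * a * suc M
    rearrange g M = solve (a ∷ x ∷ q ∷ g ∷ M ∷ [])

  linear-congruence-solvable⁺ : ∀ a b → gcd a N ∣ b → ∃[ m ] (a * suc m) % N ≡ b % N
  linear-congruence-solvable⁺ a b g∣b with linear-congruence-solvable a b g∣b
  ... | m , am≡b = m + (N ∸ 1) , (begin
      (a * suc (m + (N ∸ 1))) % N ≡⟨ cong (λ z → (a * z) % N) (trans (sym (+-suc m (N ∸ 1))) (cong (m +_) suc[N∸1]≡N)) ⟩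
      (a * (m + N)) % N           ≡⟨ cong (_% N) (*-distribˡ-+ a m N) ⟩
      (a * m + a * N) % N         ≡⟨ [m+kn]%n≡m%n (a * m) a N ⟩
      (a * m) % N                 ≡⟨ am≡b ⟩
      b % N                       ∎)
    where open ≡-Reasoning

module _ (p : ℕ) where
  private instance
    2^p-nonZero : NonZero (2 ^ p)
    2^p-nonZero = m^n≢0 2 p

  multiples-mod-2^-total : ∀ a b →
    (∃[ m ] (a * suc m) % 2 ^ p ≡ b % 2 ^ p) ⊎ (∃[ m ] (b * suc m) % 2 ^ p ≡ a % 2 ^ p)
  multiples-mod-2^-total a b = Sum.map
    (λ ga∣gb → linear-congruence-solvable⁺ (2 ^ p) a b (∣-trans ga∣gb (gcd[m,n]∣m b _)))
    (λ gb∣ga → linear-congruence-solvable⁺ (2 ^ p) b a (∣-trans gb∣ga (gcd[m,n]∣m a _)))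
    (divisors-of-2^-total p (gcd[m,n]∣n a (2 ^ p)) (gcd[m,n]∣n b (2 ^ p)))

SharedEndpoint : {A : Set} → (A → ℕ) → (A → ℕ) → A → A → Set
SharedEndpoint end₁ end₂ u v =
  end₁ u ≡ end₁ v ⊎ end₁ u ≡ end₂ v ⊎ end₂ u ≡ end₁ v ⊎ end₂ u ≡ end₂ v

SharedEndpoint-sym : ∀ {A} {end₁ end₂ : A → ℕ} {u v} →
  SharedEndpoint end₁ end₂ u v → SharedEndpoint end₁ end₂ v u
SharedEndpoint-sym (inj₁ e)               = inj₁ (sym e)
SharedEndpoint-sym (inj₂ (inj₁ e))        = inj₂ (inj₂ (inj₁ (sym e)))
SharedEndpoint-sym (inj₂ (inj₂ (inj₁ e))) = inj₂ (inj₁ (sym e))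
SharedEndpoint-sym (inj₂ (inj₂ (inj₂ e))) = inj₂ (inj₂ (inj₂ (sym e)))

edge-≡ : ∀ {k E} {s s' t t' : Fin k} .{s<t s'<t' e e'} →
  s ≡ s' → t ≡ t' → edge {k} {E} s t s<t e ≡ edge s' t' s'<t' e'
edge-≡ refl refl = refl

≡⇔fromℕ<≡fromℕ< : ∀ {m n k} .(m<k : m < k) .(n<k : n < k) → m ≡ n ⇔ fromℕ< m<k ≡ fromℕ< n<k
≡⇔fromℕ<≡fromℕ< {m} {n} m<k n<k = mk⇔ (λ m≡n → fromℕ<-cong m n m≡n m<k n<k) (fromℕ<-injective m n m<k n<k)

module _ (Γ : Graph) {k : ℕ} (end₁ end₂ : V Γ → ℕ)
         (end₁<end₂ : ∀ v → end₁ v < end₂ v) (end₂<k : ∀ v → end₂ v < k)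
         (ends-injective : ∀ {u v} → end₁ u ≡ end₁ v → end₂ u ≡ end₂ v → u ≡ v)
         (ends? : ∀ s t → Dec (∃ λ v → end₁ v ≡ s × end₂ v ≡ t))
         (adj⇔shared : ∀ u v → Adj Γ u v ⇔ (u ≢ v × SharedEndpoint end₁ end₂ u v))
  where

  private
    -- The proof field of an edge is irrelevant, so a vertex is recovered from its
    -- endpoints by re-running the decision procedure ends?.
    IsEdge : Fin k → Fin k → Set
    IsEdge i j = ∃ λ v → end₁ v ≡ toℕ i × end₂ v ≡ toℕ j

    end₁<k : ∀ v → end₁ v < k
    end₁<k v = <-trans (end₁<end₂ v) (end₂<k v)

    toEdge : V Γ → Edge k IsEdge
    toEdge v = edge (fromℕ< (end₁<k v)) (fromℕ< (end₂<k v))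
      (subst₂ _<_ (sym (toℕ-fromℕ< (end₁<k v))) (sym (toℕ-fromℕ< (end₂<k v))) (end₁<end₂ v))
      (v , sym (toℕ-fromℕ< _) , sym (toℕ-fromℕ< _))

    fromEdge : Edge k IsEdge → V Γ
    fromEdge (edge i j _ e) = proj₁ (recompute (ends? (toℕ i) (toℕ j)) e)

    fromEdge∘toEdge : ∀ v → fromEdge (toEdge v) ≡ v
    fromEdge∘toEdge v with recompute (ends? (toℕ (fromℕ< (end₁<k v))) (toℕ (fromℕ< (end₂<k v))))
                                     (v , sym (toℕ-fromℕ< _) , sym (toℕ-fromℕ< _))
    ... | _ , end₁-w , end₂-w = ends-injective (trans end₁-w (toℕ-fromℕ< _)) (trans end₂-w (toℕ-fromℕ< _))

    toEdge∘fromEdge : ∀ e → toEdge (fromEdge e) ≡ e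
    toEdge∘fromEdge (edge i j _ e) with recompute (ends? (toℕ i) (toℕ j)) e
    ... | _ , end₁-w , end₂-w = edge-≡ (toℕ-injective (trans (toℕ-fromℕ< _) end₁-w))
                                     (toℕ-injective (trans (toℕ-fromℕ< _) end₂-w))

    toEdge-injective : ∀ {u v} → toEdge u ≡ toEdge v → u ≡ v
    toEdge-injective {u} {v} e = trans (sym (fromEdge∘toEdge u)) (trans (cong fromEdge e) (fromEdge∘toEdge v))

    toEdge-≢⇔ : ∀ u v → (u ≢ v) ⇔ (toEdge u ≢ toEdge v)
    toEdge-≢⇔ u v = mk⇔ (λ u≢v e → u≢v (toEdge-injective e)) (λ ≢ u≡v → ≢ (cong toEdge u≡v))

    shared⇔ShareEnd : ∀ u v → SharedEndpoint end₁ end₂ u v ⇔ ShareEnd (toEdge u) (toEdge v)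
    shared⇔ShareEnd u v = ≡⇔fromℕ<≡fromℕ< _ _ ⊎-cong ≡⇔fromℕ<≡fromℕ< _ _
                       ⊎-cong ≡⇔fromℕ<≡fromℕ< _ _ ⊎-cong ≡⇔fromℕ<≡fromℕ< _ _

  labelling⇒isLineGraph : IsLineGraph Γ
  labelling⇒isLineGraph = k , IsEdge , record
    { to      = toEdge
    ; from    = fromEdge
    ; from∘to = fromEdge∘toEdge
    ; to∘from = toEdge∘fromEdge
    ; adj     = λ u v → ⇔.trans (adj⇔shared u v) (toEdge-≢⇔ u v ×-cong shared⇔ShareEnd u v)
    }

vert-injective : ∀ {Γ} {u v : NonDom Γ} → vert u ≡ vert v → u ≡ v
vert-injective refl = refl

nonDominating-≢ : ∀ Γ {u v} → .(¬ Dominating Γ u) → Dominating Γ v → u ≢ v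
nonDominating-≢ Γ ¬D D refl = ⊥-elim-irr (¬D D)

module _ (Γ : Graph) (dominating? : ∀ v → Dec (Dominating Γ v))
         {k : ℕ} (end₁ end₂ : V Γ → ℕ) (decode : ℕ → ℕ → V Γ)
         (decode-ends : ∀ v → decode (end₁ v) (end₂ v) ≡ v)
         (end₁<end₂ : ∀ v → end₁ v < end₂ v) (end₂<k : ∀ v → end₂ v < k)
         (adj⇔shared : ∀ u v → .(¬ Dominating Γ u) → .(¬ Dominating Γ v) →
                       Adj Γ u v ⇔ (u ≢ v × SharedEndpoint end₁ end₂ u v))
  where

  private
    ends-injective : ∀ {u v} → end₁ u ≡ end₁ v → end₂ u ≡ end₂ v → u ≡ v
    ends-injective {u} {v} end₁≡ end₂≡ =
      trans (sym (decode-ends u)) (trans (cong₂ decode end₁≡ end₂≡) (decode-ends v))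

    ends? : ∀ s t → Dec (∃ λ (v : NonDom Γ) → end₁ (vert v) ≡ s × end₂ (vert v) ≡ t)
    ends? s t with dominating? (decode s t) | end₁ (decode s t) ≟ s | end₂ (decode s t) ≟ t
    ... | no ¬D | yes end₁≡ | yes end₂≡ = yes (nd (decode s t) ¬D , end₁≡ , end₂≡)
    ... | yes D | _ | _ = no λ { (nd v ¬D , refl , refl) → ⊥-elim-irr (¬D (subst (Dominating Γ) (decode-ends v) D)) }
    ... | no _ | no end₁≢ | _ = no λ { (nd v _ , refl , refl) → end₁≢ (cong end₁ (decode-ends v)) }
    ... | no _ | yes _ | no end₂≢ = no λ { (nd v _ , refl , refl) → end₂≢ (cong end₂ (decode-ends v)) }

    ≢⇔vert≢ : ∀ {u v : NonDom Γ} → (u ≢ v) ⇔ (vert u ≢ vert v)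
    ≢⇔vert≢ = mk⇔ (λ u≢v e → u≢v (vert-injective e)) (λ ≢ u≡v → ≢ (cong vert u≡v))

  deleteDominating-isLineGraph : IsLineGraph (deleteDominating Γ)
  deleteDominating-isLineGraph = labelling⇒isLineGraph (deleteDominating Γ)
    (end₁ ∘ vert) (end₂ ∘ vert) (end₁<end₂ ∘ vert) (end₂<k ∘ vert)
    (λ end₁≡ end₂≡ → vert-injective (ends-injective end₁≡ end₂≡)) ends?
    (λ { (nd _ ¬Du) (nd _ ¬Dv) → ⇔.trans (adj⇔shared _ _ ¬Du ¬Dv) (⇔.sym ≢⇔vert≢ ×-cong ⇔.refl) })

PowAdj-sym : ∀ {n u v} → PowAdj n u v → PowAdj n v u
PowAdj-sym (u≢v , reach) = u≢v ∘ sym , Sum.swap reach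

module _ (n : ℕ) where

  private instance
    ord-x-nonZero : NonZero (ord-x n)
    ord-x-nonZero = m^n≢0 2 (n ∸ 1)

  x^ : ℕ → Q n
  x^ m = modx n m , false

  toℕ-modx : ∀ m → toℕ (modx n m) ≡ m % ord-x n
  toℕ-modx m = toℕ-fromℕ< _

  modx-cong : ∀ {u v} → u % ord-x n ≡ v % ord-x n → modx n u ≡ modx n v
  modx-cong e = toℕ-injective (trans (toℕ-modx _) (trans e (sym (toℕ-modx _))))

  modx-toℕ : ∀ a → modx n (toℕ a) ≡ a
  modx-toℕ a = toℕ-injective (trans (toℕ-modx _) (m<n⇒m%n≡m (toℕ<n a)))

  x^-injective : ∀ {u v} → u < ord-x n → v < ord-x n → x^ u ≡ x^ v → u ≡ v
  x^-injective {u} {v} u< v< e = begin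
    u                   ≡⟨ m<n⇒m%n≡m u< ⟨
    u % ord-x n         ≡⟨ toℕ-modx u ⟨
    toℕ (proj₁ (x^ u))  ≡⟨ cong (toℕ ∘ proj₁) e ⟩
    toℕ (proj₁ (x^ v))  ≡⟨ toℕ-modx v ⟩
    v % ord-x n         ≡⟨ m<n⇒m%n≡m v< ⟩
    v                   ∎
    where open ≡-Reasoning

  qpow-x : ∀ a m → qpow n (a , false) m ≡ x^ (toℕ a * m)
  qpow-x a zero    = cong x^ (sym (*-zeroʳ (toℕ a)))
  qpow-x a (suc m) = begin
    qmul n (a , false) (qpow n (a , false) m)  ≡⟨ cong (qmul n (a , false)) (qpow-x a m) ⟩
    x^ (toℕ a + toℕ (modx n (toℕ a * m)))      ≡⟨ cong (_, false) (modx-cong residue) ⟩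
    x^ (toℕ a * suc m)                          ∎
    where
    open ≡-Reasoning
    residue : (toℕ a + toℕ (modx n (toℕ a * m))) % ord-x n ≡ (toℕ a * suc m) % ord-x n
    residue = begin
      (toℕ a + toℕ (modx n (toℕ a * m))) % ord-x n ≡⟨ cong (λ z → (toℕ a + z) % ord-x n) (toℕ-modx _) ⟩
      (toℕ a + toℕ a * m % ord-x n) % ord-x n      ≡⟨ cong (_% ord-x n) (+-comm (toℕ a) _) ⟩
      (toℕ a * m % ord-x n + toℕ a) % ord-x n      ≡⟨ [m%n+o]%n≡[m+o]%n (toℕ a * m) (toℕ a) (ord-x n) ⟩
      (toℕ a * m + toℕ a) % ord-x n                ≡⟨ cong (_% ord-x n) (trans (+-comm _ (toℕ a)) (sym (*-suc (toℕ a) m))) ⟩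
      (toℕ a * suc m) % ord-x n                    ∎

  qpow-x-≡ : ∀ a m {b} → (toℕ a * m) % ord-x n ≡ toℕ b % ord-x n → qpow n (a , false) m ≡ (b , false)
  qpow-x-≡ a m {b} e = trans (qpow-x a m) (cong (_, false) (trans (modx-cong e) (modx-toℕ b)))

  x-adjacent : ∀ {a b} → a ≢ b → PowAdj n (a , false) (b , false)
  x-adjacent {a} {b} a≢b with multiples-mod-2^-total (n ∸ 1) (toℕ a) (toℕ b)
  ... | inj₁ (m , e) = a≢b ∘ cong proj₁ , inj₁ (m , qpow-x-≡ a (suc m) e)
  ... | inj₂ (m , e) = a≢b ∘ cong proj₁ , inj₂ (m , qpow-x-≡ b (suc m) e)

module Quaternion (p : ℕ) where

  private
    n : ℕ
    n = suc (suc p)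

    N : ℕ
    N = ord-x n

    h : ℕ
    h = 2 ^ p

    instance
      N-nonZero : NonZero N
      N-nonZero = m^n≢0 2 (suc p)
      h-nonZero : NonZero h
      h-nonZero = m^n≢0 2 p

    N≡h+h : N ≡ h + h
    N≡h+h = cong (h +_) (+-identityʳ h)

    h<N : h < N
    h<N = subst (h <_) (sym N≡h+h) (m<m+n h (>-nonZero⁻¹ h))

  _+h : Fin N → Fin N
  c +h = modx n (toℕ c + h)

  toℕ-+h-%h : ∀ c → toℕ (c +h) % h ≡ toℕ c % h
  toℕ-+h-%h c = begin
    toℕ (c +h) % h        ≡⟨ cong (_% h) (toℕ-modx n _) ⟩
    (toℕ c + h) % N % h   ≡⟨ m∣n⇒o%n%m≡o%m h N _ (divides 2 refl) ⟩
    (toℕ c + h) % h       ≡⟨ [m+n]%n≡m%n (toℕ c) h ⟩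
    toℕ c % h             ∎
    where open ≡-Reasoning

  +h-involutive : ∀ c → (c +h) +h ≡ c
  +h-involutive c = trans (modx-cong n (begin
    (toℕ (c +h) + h) % N          ≡⟨ cong (λ z → (z + h) % N) (toℕ-modx n _) ⟩
    ((toℕ c + h) % N + h) % N     ≡⟨ [m%n+o]%n≡[m+o]%n (toℕ c + h) h N ⟩
    (toℕ c + h + h) % N           ≡⟨ cong (_% N) (trans (+-assoc (toℕ c) h h) (cong (toℕ c +_) (sym N≡h+h))) ⟩
    (toℕ c + N) % N               ≡⟨ [m+n]%n≡m%n (toℕ c) N ⟩
    toℕ c % N                     ∎)) (modx-toℕ n c)
    where open ≡-Reasoning

  private
    below-2h : ∀ {x} → x < N → x ≡ x % h ⊎ x ≡ x % h + h
    below-2h {x} x<N with x <? h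
    ... | yes x<h = inj₁ (sym (m<n⇒m%n≡m x<h))
    ... | no x≮h = inj₂ (begin
      x               ≡⟨ m∸n+n≡m h≤x ⟨
      x ∸ h + h       ≡⟨ cong (_+ h) (m<n⇒m%n≡m x∸h<h) ⟨
      (x ∸ h) % h + h ≡⟨ cong (_+ h) (m≤n⇒[n∸m]%m≡n%m h≤x) ⟩
      x % h + h       ∎)
      where
      open ≡-Reasoning
      h≤x = ≮⇒≥ x≮h
      x∸h<h : x ∸ h < h
      x∸h<h = +-cancelʳ-< _ _ h (subst₂ _<_ (sym (m∸n+n≡m h≤x)) N≡h+h x<N)

  %h-≡⇒≡+h : ∀ {c d} → c ≢ d → toℕ c % h ≡ toℕ d % h → d ≡ c +h
  %h-≡⇒≡+h {c} {d} c≢d c≡d[h] with below-2h (toℕ<n c) | below-2h (toℕ<n d)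
  ... | inj₁ c≡r | inj₁ d≡r = contradiction (toℕ-injective (trans c≡r (trans c≡d[h] (sym d≡r)))) c≢d
  ... | inj₂ c≡r+h | inj₂ d≡r+h = contradiction (toℕ-injective (trans c≡r+h (trans (cong (_+ h) c≡d[h]) (sym d≡r+h)))) c≢d
  ... | inj₁ c≡r | inj₂ d≡r+h = toℕ-injective (begin
    toℕ d                 ≡⟨ d≡r+h ⟩
    toℕ d % h + h         ≡⟨ m<n⇒m%n≡m r+h<N ⟨
    (toℕ d % h + h) % N   ≡⟨ cong (λ z → (z + h) % N) (trans (sym c≡d[h]) (sym c≡r)) ⟩
    (toℕ c + h) % N       ≡⟨ toℕ-modx n _ ⟨
    toℕ (c +h)            ∎)
    where
    open ≡-Reasoning
    r+h<N : toℕ d % h + h < N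
    r+h<N = subst (toℕ d % h + h <_) (sym N≡h+h) (+-monoˡ-< h (m%n<n (toℕ d) h))
  ... | inj₂ c≡r+h | inj₁ d≡r = toℕ-injective (begin
    toℕ d                   ≡⟨ d≡r ⟩
    toℕ d % h               ≡⟨ m<n⇒m%n≡m (<-trans (m%n<n (toℕ d) h) h<N) ⟨
    toℕ d % h % N           ≡⟨ [m+n]%n≡m%n (toℕ d % h) N ⟨
    (toℕ d % h + N) % N     ≡⟨ cong (_% N) (trans (cong (toℕ d % h +_) N≡h+h) (sym (+-assoc (toℕ d % h) h h))) ⟩
    (toℕ d % h + h + h) % N ≡⟨ cong (λ z → (z + h + h) % N) (sym c≡d[h]) ⟩
    (toℕ c % h + h + h) % N ≡⟨ cong (λ z → (z + h) % N) c≡r+h ⟨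
    (toℕ c + h) % N         ≡⟨ toℕ-modx n _ ⟨
    toℕ (c +h)              ∎)
    where open ≡-Reasoning

  private
    toℕ-modx-0 : toℕ (modx n 0) ≡ 0
    toℕ-modx-0 = trans (toℕ-modx n 0) (m<n⇒m%n≡m (>-nonZero⁻¹ N))

    toℕ-modx-h : toℕ (modx n h) ≡ h
    toℕ-modx-h = trans (toℕ-modx n h) (m<n⇒m%n≡m h<N)

  y·1 : ∀ c → qmul n (c , true) (x^ n 0) ≡ (c , true)
  y·1 c = cong (_, true) (trans (modx-cong n (begin
    (toℕ c + (N ∸ toℕ (modx n 0))) % N ≡⟨ cong (λ z → (toℕ c + (N ∸ z)) % N) toℕ-modx-0 ⟩
    (toℕ c + N) % N                    ≡⟨ [m+n]%n≡m%n (toℕ c) N ⟩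
    toℕ c % N                          ∎)) (modx-toℕ n c))
    where open ≡-Reasoning

  y·y : ∀ c → qmul n (c , true) (c , true) ≡ x^ n h
  y·y c = cong (_, false) (modx-cong n (begin
    (toℕ c + (N ∸ toℕ c) + h) % N ≡⟨ cong (λ z → (z + h) % N) (m+[n∸m]≡n (<⇒≤ (toℕ<n c))) ⟩
    (N + h) % N                   ≡⟨ cong (_% N) (+-comm N h) ⟩
    (h + N) % N                   ≡⟨ [m+n]%n≡m%n h N ⟩
    h % N                         ∎))
    where open ≡-Reasoning

  y·x^h : ∀ c → qmul n (c , true) (x^ n h) ≡ (c +h , true)
  y·x^h c = cong (λ z → modx n (toℕ c + z) , true) N∸h≡h
    where
    N∸h≡h : N ∸ toℕ (modx n h) ≡ h
    N∸h≡h = trans (cong (N ∸_) toℕ-modx-h) (trans (cong (_∸ h) N≡h+h) (m+n∸n≡m h h))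

  y·y+h : ∀ c → qmul n (c , true) (c +h , true) ≡ x^ n 0
  y·y+h c = cong (_, false) (modx-cong n (begin
    (toℕ c + (N ∸ t) + h) % N         ≡⟨ cong (_% N) (trans (+-assoc (toℕ c) _ h) (trans (cong (toℕ c +_) (+-comm (N ∸ t) h)) (sym (+-assoc (toℕ c) h _)))) ⟩
    (toℕ c + h + (N ∸ t)) % N         ≡⟨ [m%n+o]%n≡[m+o]%n (toℕ c + h) (N ∸ t) N ⟨
    ((toℕ c + h) % N + (N ∸ t)) % N   ≡⟨ cong (λ z → (z + (N ∸ t)) % N) (toℕ-modx n _) ⟨
    (t + (N ∸ t)) % N                 ≡⟨ cong (_% N) (m+[n∸m]≡n (<⇒≤ (toℕ<n (c +h)))) ⟩
    N % N                             ≡⟨ n%n≡0 N ⟩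
    0                                 ≡⟨ m<n⇒m%n≡m (>-nonZero⁻¹ N) ⟨
    0 % N                             ∎))
    where
    open ≡-Reasoning
    t = toℕ (c +h)

  y^2 : ∀ c → qpow n (c , true) 2 ≡ x^ n h
  y^2 c = trans (cong (qmul n (c , true)) (y·1 c)) (y·y c)

  y^3 : ∀ c → qpow n (c , true) 3 ≡ (c +h , true)
  y^3 c = trans (cong (qmul n (c , true)) (y^2 c)) (y·x^h c)

  y^4 : ∀ c → qpow n (c , true) 4 ≡ x^ n 0
  y^4 c = trans (cong (qmul n (c , true)) (y^3 c)) (y·y+h c)

  y-powers : Fin N → List (Q n)
  y-powers c = (c , true) ∷ x^ n h ∷ (c +h , true) ∷ x^ n 0 ∷ []

  qpow-y-∈ : ∀ c m → qpow n (c , true) m ∈ y-powers c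
  qpow-y-∈ c zero = there (there (there (here refl)))
  qpow-y-∈ c (suc m) with qpow-y-∈ c m
  ... | here e                         = there (here (trans (cong (qmul n (c , true)) e) (y·y c)))
  ... | there (here e)                 = there (there (here (trans (cong (qmul n (c , true)) e) (y·x^h c))))
  ... | there (there (here e))         = there (there (there (here (trans (cong (qmul n (c , true)) e) (y·y+h c)))))
  ... | there (there (there (here e))) = here (trans (cong (qmul n (c , true)) e) (y·1 c))

  x∉y-powers : ∀ {a c} → (a , false) ≢ x^ n 0 → (a , false) ≢ x^ n h → (a , false) ∉ y-powers c
  x∉y-powers ≢1 ≢x^h (there (here e))                 = ≢x^h e
  x∉y-powers ≢1 ≢x^h (there (there (there (here e)))) = ≢1 e

  y∈y-powers : ∀ {c d} → (d , true) ∈ y-powers c → d ≡ c ⊎ d ≡ c +h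
  y∈y-powers (here e)                 = inj₁ (cong proj₁ e)
  y∈y-powers (there (there (here e))) = inj₂ (cong proj₁ e)
  y∈y-powers (there (there (there (there ()))))

  x-y-nonadjacent : ∀ {a c} → (a , false) ≢ x^ n 0 → (a , false) ≢ x^ n h →
                    ¬ PowAdj n (a , false) (c , true)
  x-y-nonadjacent {a} ≢1 ≢x^h (_ , inj₁ (m , e)) with trans (sym (qpow-x n a (suc m))) e
  ... | ()
  x-y-nonadjacent {c = c} ≢1 ≢x^h (_ , inj₂ (m , e)) =
    x∉y-powers ≢1 ≢x^h (subst (_∈ y-powers c) e (qpow-y-∈ c (suc m)))

  y-adjacent⇒≡+h : ∀ {c d} → PowAdj n (c , true) (d , true) → d ≡ c +h
  y-adjacent⇒≡+h {c} {d} (c≢d , inj₁ (m , e)) with y∈y-powers (subst (_∈ y-powers c) e (qpow-y-∈ c (suc m)))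
  ... | inj₁ d≡c  = contradiction (cong (_, true) (sym d≡c)) c≢d
  ... | inj₂ d≡c+h = d≡c+h
  y-adjacent⇒≡+h {c} {d} (c≢d , inj₂ (m , e)) with y∈y-powers (subst (_∈ y-powers d) e (qpow-y-∈ d (suc m)))
  ... | inj₁ c≡d  = contradiction (cong (_, true) c≡d) c≢d
  ... | inj₂ c≡d+h = trans (sym (+h-involutive d)) (cong _+h (sym c≡d+h))

  x^0-dominating : Dominating (PowerGraph n) (x^ n 0)
  x^0-dominating (a , false) ≢1 = x-adjacent n (≢1 ∘ sym ∘ cong (_, false))
  x^0-dominating (c , true) ≢1  = ≢1 ∘ sym , inj₂ (3 , y^4 c)

  x^h-dominating : Dominating (PowerGraph n) (x^ n h)
  x^h-dominating (a , false) ≢x^h = x-adjacent n (≢x^h ∘ sym ∘ cong (_, false))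
  x^h-dominating (c , true) ≢x^h  = ≢x^h ∘ sym , inj₂ (1 , y^2 c)

  x-nonDominating : ∀ {a} → (a , false) ≢ x^ n 0 → (a , false) ≢ x^ n h →
                    ¬ Dominating (PowerGraph n) (a , false)
  x-nonDominating ≢1 ≢x^h D = x-y-nonadjacent ≢1 ≢x^h (D (modx n 0 , true) λ ())

  nonDominating-x-y-nonadjacent : ∀ {a c} → .(¬ Dominating (PowerGraph n) (a , false)) →
                                  ¬ PowAdj n (a , false) (c , true)
  nonDominating-x-y-nonadjacent ¬D = x-y-nonadjacent
    (nonDominating-≢ (PowerGraph n) ¬D x^0-dominating) (nonDominating-≢ (PowerGraph n) ¬D x^h-dominating)

  y-nonDominating : 1 < h → ∀ {c} → ¬ Dominating (PowerGraph n) (c , true)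
  y-nonDominating 1<h D = x-y-nonadjacent x≢1 x≢x^h (PowAdj-sym (D (x^ n 1) λ ()))
    where
    1<N = <-trans 1<h h<N
    x≢1 : x^ n 1 ≢ x^ n 0
    x≢1 e = contradiction (x^-injective n 1<N (>-nonZero⁻¹ N) e) λ ()
    x≢x^h : x^ n 1 ≢ x^ n h
    x≢x^h e = <⇒≢ 1<h (x^-injective n 1<N h<N e)

  dominating? : 1 < h → ∀ g → Dec (Dominating (PowerGraph n) g)
  dominating? 1<h (c , true) = no (y-nonDominating 1<h)
  dominating? 1<h (a , false) with a ≟ᶠ modx n 0 | a ≟ᶠ modx n h
  ... | yes refl | _        = yes x^0-dominating
  ... | no _     | yes refl = yes x^h-dominating
  ... | no a≢0   | no a≢h   = no (x-nonDominating (a≢0 ∘ cong proj₁) (a≢h ∘ cong proj₁))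

  end₁ end₂ : Q n → ℕ
  end₁ (a , false) = 0
  end₁ (c , true)  = suc (N + toℕ c % h)
  end₂ (a , false) = suc (toℕ a)
  end₂ (c , true)  = suc (N + h + toℕ c)

  end₁<end₂ : ∀ g → end₁ g < end₂ g
  end₁<end₂ (a , false) = z<s
  end₁<end₂ (c , true)  = s<s (subst (N + toℕ c % h <_) (sym (+-assoc N h (toℕ c)))
                                (+-monoʳ-< N (<-≤-trans (m%n<n (toℕ c) h) (m≤m+n h (toℕ c)))))

  end₂<1+N+h+N : ∀ g → end₂ g < suc (N + h + N)
  end₂<1+N+h+N (a , false) = s<s (<-≤-trans (toℕ<n a) (m≤n+m N (N + h)))
  end₂<1+N+h+N (c , true)  = s<s (+-monoʳ-< (N + h) (toℕ<n c))

  decode : ℕ → ℕ → Q n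
  decode zero    t = x^ n (t ∸ 1)
  decode (suc _) t = modx n (t ∸ suc (N + h)) , true

  decode-ends : ∀ g → decode (end₁ g) (end₂ g) ≡ g
  decode-ends (a , false) = cong (_, false) (modx-toℕ n a)
  decode-ends (c , true)  = cong (_, true) (trans (cong (modx n) (m+n∸m≡n (N + h) (toℕ c))) (modx-toℕ n c))

  private
    Shared : Q n → Q n → Set
    Shared = SharedEndpoint end₁ end₂

    <⇒≢+ : ∀ {x} m {y} → x < m → x ≢ m + y
    <⇒≢+ m {y} x<m refl = <⇒≱ x<m (m≤m+n m y)

  x-y-unshared : ∀ {a c} → ¬ Shared (a , false) (c , true)
  x-y-unshared {a} {c} (inj₂ (inj₂ (inj₁ e))) = <⇒≢+ N (toℕ<n a) (suc-injective e)
  x-y-unshared {a} {c} (inj₂ (inj₂ (inj₂ e))) = <⇒≢+ N (toℕ<n a) (trans (suc-injective e) (+-assoc N h (toℕ c)))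

  y-shared⇔≡+h : ∀ {c d} → (c , true) ≢ (d , true) → Shared (c , true) (d , true) ⇔ d ≡ c +h
  y-shared⇔≡+h {c} {d} y≢y' = mk⇔ shared⇒ (λ { refl → inj₁ (cong (λ r → suc (N + r)) (sym (toℕ-+h-%h c))) })
    where
    c≢d = y≢y' ∘ cong (_, true)
    hub<leaf : ∀ c d → N + toℕ c % h ≢ N + h + d
    hub<leaf c d e = <⇒≢+ h (m%n<n (toℕ c) h) (+-cancelˡ-≡ N _ _ (trans e (+-assoc N h d)))
    shared⇒ : Shared (c , true) (d , true) → d ≡ c +h
    shared⇒ (inj₁ e)               = %h-≡⇒≡+h c≢d (+-cancelˡ-≡ N _ _ (suc-injective e))
    shared⇒ (inj₂ (inj₁ e))        = contradiction (suc-injective e) (hub<leaf c (toℕ d))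
    shared⇒ (inj₂ (inj₂ (inj₁ e))) = contradiction (sym (suc-injective e)) (hub<leaf d (toℕ c))
    shared⇒ (inj₂ (inj₂ (inj₂ e))) = contradiction (toℕ-injective (+-cancelˡ-≡ (N + h) _ _ (suc-injective e))) c≢d

  adjacent⇔shared : ∀ u v → .(¬ Dominating (PowerGraph n) u) → .(¬ Dominating (PowerGraph n) v) →
                    PowAdj n u v ⇔ (u ≢ v × Shared u v)
  adjacent⇔shared (a , false) (b , false) _ _ =
    mk⇔ (λ adj → proj₁ adj , inj₁ refl) (λ (u≢v , _) → x-adjacent n (u≢v ∘ cong (_, false)))
  adjacent⇔shared (a , false) (c , true) ¬Du _ =
    mk⇔ (⊥-elim ∘ nonDominating-x-y-nonadjacent ¬Du) (⊥-elim ∘ x-y-unshared ∘ proj₂)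
  adjacent⇔shared (c , true) (a , false) _ ¬Dv =
    mk⇔ (⊥-elim ∘ nonDominating-x-y-nonadjacent ¬Dv ∘ PowAdj-sym)
        (⊥-elim ∘ x-y-unshared ∘ SharedEndpoint-sym {end₁ = end₁} {end₂} ∘ proj₂)
  adjacent⇔shared (c , true) (d , true) _ _ = mk⇔
    (λ adj → proj₁ adj , Equivalence.from (y-shared⇔≡+h (proj₁ adj)) (y-adjacent⇒≡+h adj))
    (λ (u≢v , shared) → u≢v , inj₁ (2 , y^3-≡ (Equivalence.to (y-shared⇔≡+h u≢v) shared)))
    where
    y^3-≡ : d ≡ c +h → qpow n (c , true) 3 ≡ (d , true)
    y^3-≡ refl = y^3 c

mainTheorem5 : (n : ℕ) → 3 ≤ n → IsLineGraph (ProperPowerGraph n)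
mainTheorem5 (suc (suc (suc k))) (s≤s (s≤s (s≤s z≤n))) =
  deleteDominating-isLineGraph (PowerGraph (3 + k)) (dominating? 1<h)
    end₁ end₂ decode decode-ends end₁<end₂ end₂<1+N+h+N adjacent⇔shared
  where
  open Quaternion (suc k)
  1<h : 1 < 2 ^ suc k
  1<h = ^-monoʳ-< 2 (s≤s (s≤s z≤n)) {0} {suc k} z<s
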